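{- Let $G=(V,E)$ be a finite directed graph in which every vertex has indegree greater than $0$, fix a total order on $E$, and let $\langle l_v\rangle_{v\in V}$ be a tree array of $G$. When the algorithm $\sigma$ is run on $\langle l_v\rangle$, then every time Step 1 is executed the set $R$ is non-empty, and every time Step 2 is executed the list $l_{t(f)}$ is non-empty. (Thus the algorithm is well-defined.)
   Context: Each edge $e$ has source $s(e)$ and target $t(e)$. The directed line graph $\mathcal{L}G$ has vertex set $E$ and an edge $(e,f)$ for each pair of edges with $t(e)=s(f)$. An oriented spanning tree of $G$ rooted at $r$ is a subgraph containing all vertices in which every vertex has a unique directed path to $r$. A list is a finite ordered tuple; popping a list removes its first element; $N(l,e)$ denotes the number of occurrences of $e$ in list $l$ (at the current moment). A tree array of $G$ is an assignment of a list $l_v$ to each $v\in V$ for which there exist an oriented spanning tree $T$ of $G$ with root $r$ such that: $l_v$ has length $\mathrm{indeg}(v)$; for each $v$, the first $\mathrm{indeg}(v)-1$ entries of $l_v$ are edges with source $v$; for $v\neq r$, the last entry of $l_v$ is the unique edge of $T$ with source $v$; the last entry of $l_r$ is a special symbol $\Omega$ (not an edge). The algorithm $\sigma$ starts with a tree array $\langle l_v\rangle$ and the empty subgraph $T'$ of $\mathcal{L}G$ (no edges) and repeats: Step 1: let $R$ be the set of edges $e\in E$ with $N(l_{s(e)},e)=0$ and $\mathrm{outdeg}_{T'}(e)=0$, and let $f$ be the smallest element of $R$. Step 2: pop the first element $g$ from $l_{t(f)}$; if $g=\Omega$, output $T'$ and stop. Step 3: otherwise $g\in E$ with $s(g)=t(f)$;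 add the edge $(f,g)$ to $T'$ and return to Step 1. -}

module Defs where

open import Data.Nat using (ℕ; zero; suc; _<_)
open import Data.Fin using (Fin; _≟_) renaming (_≤_ to _≤ᶠ_)
open import Data.List using (List; []; _∷_; _++_; map; length; filter; allFin)
open import Data.List.Relation.Unary.All using (All)
open import Data.Product using (Σ; Σ-syntax; _×_; _,_; proj₁; ∃)
open import Data.Fin.Subset using (Subset; _∈_)
open import Relation.Binary.PropositionalEquality using (_≡_; _≢_)
open import Relation.Nullary using (¬_; does)
open import Data.Bool using (if_then_else_)

-- A finite directed multigraph (loops / parallel edges allowed):
-- vertices Fin n, edges Fin m; the fixed total order on E is the order of Fin m.
record Graph : Set where
  field
    n   : ℕ
    m   : ℕ
    src : Fin m → Fin n
    tgt : Fin m → Fin n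

module _ (G : Graph) where
  open Graph G

  Vtx  = Fin n
  Edge = Fin m

  indeg : Vtx → ℕ
  indeg v = length (filter (λ e → tgt e ≟ v) (allFin m))

  IsWalk : Subset m → Vtx → Vtx → List Edge → Set
  IsWalk T v w []       = v ≡ w
  IsWalk T v w (e ∷ es) = (e ∈ T) × (src e ≡ v) × IsWalk T (tgt e) w es

  OrientedSpanningTree : Vtx → Subset m → Set
  OrientedSpanningTree r T =
    ∀ v → (Σ[ es ∈ List Edge ] IsWalk T v r es)
        × (∀ es es' → IsWalk T v r es → IsWalk T v r es' → es ≡ es')

data Sym (m : ℕ) : Set where
  ed : Fin m → Sym m
  Ω  : Sym m

module _ (G : Graph) where
  open Graph G

  LastOK : Vtx G → Subset m → Vtx G → Sym m → Set
  LastOK r T v x =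
    (v ≡ r → x ≡ Ω) ×
    (v ≢ r → Σ[ e ∈ Edge G ] (x ≡ ed e) × (e ∈ T) × (src e ≡ v)
               × (∀ e' → e' ∈ T → src e' ≡ v → e' ≡ e))

  TreeArrayFor : Vtx G → Subset m → (Vtx G → List (Sym m)) → Set
  TreeArrayFor r T l =
    ∀ v → length (l v) ≡ indeg G v
        × Σ[ es ∈ List (Edge G) ] Σ[ x ∈ Sym m ]
            (l v ≡ map ed es ++ (x ∷ [])) × All (λ e → src e ≡ v) es × LastOK r T v x

  TreeArray : (Vtx G → List (Sym m)) → Set
  TreeArray l = Σ[ r ∈ Vtx G ] Σ[ T ∈ Subset m ]
    OrientedSpanningTree G r T × TreeArrayFor r T l

  N : List (Sym m) → Edge G → ℕ
  N []          e = 0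
  N (ed e' ∷ xs) e = if does (e' ≟ e) then suc (N xs e) else N xs e
  N (Ω ∷ xs)    e = N xs e

  -- the edges of T' (a subgraph of the line graph) as a list of pairs (f , g)
  LEdges = List (Edge G × Edge G)

  outdeg : LEdges → Edge G → ℕ
  outdeg T' e = length (filter (λ p → proj₁ p ≟ e) T')

  State = (Vtx G → List (Sym m)) × LEdges

  InR : State → Edge G → Set
  InR (l , T') e = (N (l (src e)) e ≡ 0) × (outdeg T' e ≡ 0)

  IsMinR : State → Edge G → Set
  IsMinR S f = InR S f × (∀ e → InR S e → f ≤ᶠ e)

  setList : (Vtx G → List (Sym m)) → Vtx G → List (Sym m) → Vtx G → List (Sym m)
  setList l u xs v = if does (v ≟ u) then xs else l v

  -- one full pass Steps 1-3 that does not stop (popped element is an edge g)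
  data Step : State → State → Set where
    step : ∀ l T' f g rest →
           IsMinR (l , T') f →
           l (tgt f) ≡ ed g ∷ rest →
           Step (l , T') (setList l (tgt f) rest , (f , g) ∷ T')

  -- states at which Step 1 is executed, for the run started on l₀
  data Reachable (l₀ : Vtx G → List (Sym m)) : State → Set where
    init : Reachable l₀ (l₀ , [])
    next : ∀ {S S'} → Reachable l₀ S → Step S S' → Reachable l₀ S'

module Submission where

-- The algorithm σ is well defined because every reachable state satisfies
-- an invariant made of two parts:
--   (a) every list l_v has exactly as many entries as there are edges
--       e with t(e) = v that are still "pending", i.e. have outdegree 0
--       in T' (each pass pops one entry of l_{t(f)} and makes f
--       non-pending, so both sides drop by one exactly at v = t(f));
--   (b) the symbol Ω is still present in some list (it sits at the end
--       of l_r initially, and only edges are ever popped).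
-- From (a) and (b), Σ_e N(l_{s(e)}, e) ≤ (number of edge entries in all
-- lists) < (total length of all lists) = (number of pending edges), so
-- some pending edge e has N(l_{s(e)}, e) = 0: the set R is non-empty.
-- And if f is pending then (a) gives |l_{t(f)}| ≥ 1.
-- The file first proves general facts about finite sums over Fin k, then
-- the counting facts about the algorithm, then the invariant, and finally
-- the theorem.

open import Defs
open import Data.Nat using (ℕ; zero; suc; _+_; _*_; _≤_; _<_; _≤?_; z≤n; s≤s)
open import Data.Nat.Properties
  using ( +-*-semiring; +-comm; +-assoc; +-identityʳ; *-identityʳ; *-zeroʳ
        ; +-cancelʳ-≡; +-mono-≤; +-mono-<-≤; m≤m+n; m≤n⇒m≤1+n; m<n⇒m<1+n
        ; <⇒≱; ≰⇒>; n≮0; ≤-reflexive; module ≤-Reasoning)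
open import Data.Fin using (Fin; _≟_; punchIn)
open import Data.Fin.Properties using (punchInᵢ≢i; ¬∀⟶∃¬)
open import Data.List using (List; []; _∷_; map; length; filter; tabulate)
open import Data.List.Membership.Propositional using (_∈_)
open import Data.List.Membership.Propositional.Properties using (∈-++⁺ʳ)
open import Data.List.Relation.Unary.Any using (here; there)
open import Data.Product using (Σ-syntax; ∃-syntax; _×_; _,_; proj₁; proj₂; map₂)
open import Data.Bool using (true; false; if_then_else_)
open import Function using (_∘_)
open import Relation.Nullary using (does; yes; no; contradiction)
open import Relation.Unary using (Decidable)
open import Relation.Binary.PropositionalEquality
open import Algebra.Properties.Semiring.Sum +-*-semiring
  using (sum; sum-remove; sum-cong-≗; sum-replicate-zero; ∑-comm; ∑-distrib-+; *-distribʳ-sum)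

sum-mono : ∀ {k} {g h : Fin k → ℕ} → (∀ i → g i ≤ h i) → sum g ≤ sum h
sum-mono {zero}  g≤h = z≤n
sum-mono {suc k} g≤h = +-mono-≤ (g≤h Fin.zero) (sum-mono (g≤h ∘ Fin.suc))

term≤sum : ∀ {k} (g : Fin k → ℕ) (j : Fin k) → g j ≤ sum g
term≤sum {suc k} g j = subst (g j ≤_) (sym (sum-remove {i = j} g)) (m≤m+n _ _)

sum-mono-< : ∀ {k} {g h : Fin k → ℕ} (j : Fin k) →
             (∀ i → g i ≤ h i) → g j < h j → sum g < sum h
sum-mono-< {suc k} {g} {h} j g≤h gj<hj =
  subst₂ _<_ (sym (sum-remove {i = j} g)) (sym (sum-remove {i = j} h))
    (+-mono-<-≤ gj<hj (sum-mono (g≤h ∘ punchIn j)))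

sum-<-witness : ∀ {k} (g h : Fin k → ℕ) → sum g < sum h → ∃[ i ] g i < h i
sum-<-witness g h lt =
  map₂ ≰⇒> (¬∀⟶∃¬ _ (λ i → h i ≤ g i) (λ i → h i ≤? g i) (<⇒≱ lt ∘ sum-mono))

sum-update : ∀ {k} (g h : Fin k → ℕ) (j : Fin k) →
             (∀ i → i ≢ j → g i ≡ h i) → sum g + h j ≡ sum h + g j
sum-update {suc k} g h j agree = begin
    sum g + h j                     ≡⟨ cong (_+ h j) (sum-remove {i = j} g) ⟩
    g j + sum (g ∘ punchIn j) + h j ≡⟨ cong (λ s → g j + s + h j) rest-equal ⟩
    g j + sum (h ∘ punchIn j) + h j ≡⟨ swap-outer (g j) _ (h j) ⟩
    h j + sum (h ∘ punchIn j) + g j ≡⟨ cong (_+ g j) (sym (sum-remove {i = j} h)) ⟩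
    sum h + g j                     ∎
  where
  open ≡-Reasoning
  rest-equal : sum (g ∘ punchIn j) ≡ sum (h ∘ punchIn j)
  rest-equal = sum-cong-≗ (λ i → agree (punchIn j i) (punchInᵢ≢i j i))
  swap-outer : ∀ a s b → a + s + b ≡ b + s + a
  swap-outer a s b =
    trans (+-comm (a + s) b) (trans (cong (b +_) (+-comm a s)) (sym (+-assoc b s a)))

indicator : ∀ {k} → Fin k → Fin k → ℕ
indicator a b = if does (a ≟ b) then 1 else 0

indicator-self : ∀ {k} (a : Fin k) → indicator a a ≡ 1
indicator-self a with a ≟ a
... | yes _  = refl
... | no a≢a = contradiction refl a≢a

indicator-other : ∀ {k} {a b : Fin k} → a ≢ b → indicator a b ≡ 0
indicator-other {a = a} {b} a≢b with a ≟ b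
... | yes a≡b = contradiction a≡b a≢b
... | no _    = refl

sum-indicator : ∀ {k} (a : Fin k) → sum (indicator a) ≡ 1
sum-indicator {k} a = +-cancelʳ-≡ 0 _ _ (begin
    sum (indicator a) + 0             ≡⟨ sum-update (indicator a) (λ _ → 0) a
                                           (λ i i≢a → indicator-other (i≢a ∘ sym)) ⟩
    sum {k} (λ _ → 0) + indicator a a ≡⟨ cong₂ _+_ (sum-replicate-zero k) (indicator-self a) ⟩
    1 + 0                             ∎)
  where open ≡-Reasoning

length-filter-tabulate : ∀ {A : Set} {P : A → Set} (P? : Decidable P) {k} (f : Fin k → A) →
  length (filter P? (tabulate f)) ≡ sum (λ i → if does (P? (f i)) then 1 else 0)
length-filter-tabulate P? {zero}  f = refl
length-filter-tabulate P? {suc k} f with does (P? (f Fin.zero))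
... | true  = cong suc (length-filter-tabulate P? (f ∘ Fin.suc))
... | false = length-filter-tabulate P? (f ∘ Fin.suc)

zero-indicator : ℕ → ℕ
zero-indicator zero    = 1
zero-indicator (suc _) = 0

module Counting (G : Graph) where
  open Graph G

  pending : LEdges G → Edge G → ℕ
  pending T e = zero-indicator (outdeg G T e)

  incoming : LEdges G → Vtx G → ℕ
  incoming T v = sum (λ e → indicator (tgt e) v * pending T e)

  pending-extend-self : ∀ T (f g : Edge G) → pending ((f , g) ∷ T) f ≡ 0
  pending-extend-self T f g with f ≟ f
  ... | yes _  = refl
  ... | no f≢f = contradiction refl f≢f

  pending-extend-other : ∀ T (f g e : Edge G) → e ≢ f → pending ((f , g) ∷ T) e ≡ pending T e
  pending-extend-other T f g e e≢f with f ≟ e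
  ... | yes f≡e = contradiction (sym f≡e) e≢f
  ... | no _    = refl

  incoming-extend : ∀ T (f g : Edge G) (v : Vtx G) → pending T f ≡ 1 →
    incoming T v ≡ indicator (tgt f) v + incoming ((f , g) ∷ T) v
  incoming-extend T f g v f-pending = +-cancelʳ-≡ 0 _ _ (begin
      incoming T v + 0                      ≡⟨ cong (incoming T v +_) (sym after-f) ⟩
      incoming T v + term ((f , g) ∷ T) f   ≡⟨ sum-update (term T) (term ((f , g) ∷ T)) f
                                                  (λ e e≢f → cong (indicator (tgt e) v *_)
                                                     (sym (pending-extend-other T f g e e≢f))) ⟩
      incoming ((f , g) ∷ T) v + term T f   ≡⟨ cong (incoming ((f , g) ∷ T) v +_) before-f ⟩
      incoming ((f , g) ∷ T) v + indicator (tgt f) v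
                                            ≡⟨ +-comm _ (indicator (tgt f) v) ⟩
      indicator (tgt f) v + incoming ((f , g) ∷ T) v
                                            ≡⟨ sym (+-identityʳ _) ⟩
      indicator (tgt f) v + incoming ((f , g) ∷ T) v + 0 ∎)
    where
    open ≡-Reasoning
    term : LEdges G → Edge G → ℕ
    term T' e = indicator (tgt e) v * pending T' e
    after-f : term ((f , g) ∷ T) f ≡ 0
    after-f = trans (cong (indicator (tgt f) v *_) (pending-extend-self T f g))
                    (*-zeroʳ (indicator (tgt f) v))
    before-f : term T f ≡ indicator (tgt f) v
    before-f = trans (cong (indicator (tgt f) v *_) f-pending) (*-identityʳ _)

  -- Initially every edge is pending, so incoming counts are indegrees.
  incoming-initial : ∀ v → incoming [] v ≡ indeg G v
  incoming-initial v = begin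
      sum (λ e → indicator (tgt e) v * 1) ≡⟨ sum-cong-≗ (λ e → *-identityʳ (indicator (tgt e) v)) ⟩
      sum (λ e → indicator (tgt e) v)     ≡⟨ sym (length-filter-tabulate (λ e → tgt e ≟ v) (λ e → e)) ⟩
      indeg G v                           ∎
    where open ≡-Reasoning

  -- Every edge enters exactly one vertex, so the incoming counts add up
  -- to the number of pending edges.
  sum-incoming : ∀ T → sum (incoming T) ≡ sum (pending T)
  sum-incoming T = begin
      sum (λ v → sum (λ e → indicator (tgt e) v * pending T e))
                                 ≡⟨ ∑-comm (λ v e → indicator (tgt e) v * pending T e) ⟩
      sum (λ e → sum (λ v → indicator (tgt e) v * pending T e))
                                 ≡⟨ sum-cong-≗ (λ e → sym (*-distribʳ-sum (pending T e) (indicator (tgt e)))) ⟩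
      sum (λ e → sum (indicator (tgt e)) * pending T e)
                                 ≡⟨ sum-cong-≗ (λ e → cong (_* pending T e) (sum-indicator (tgt e))) ⟩
      sum (λ e → 1 * pending T e) ≡⟨ sum-cong-≗ (λ e → +-identityʳ (pending T e)) ⟩
      sum (pending T)            ∎
    where open ≡-Reasoning

  N-cons : ∀ e' xs e → N G (ed e' ∷ xs) e ≡ indicator e' e + N G xs e
  N-cons e' xs e with e' ≟ e
  ... | yes _ = refl
  ... | no _  = refl

  sum-N-cons : ∀ e' xs → sum (N G (ed e' ∷ xs)) ≡ suc (sum (N G xs))
  sum-N-cons e' xs = begin
      sum (N G (ed e' ∷ xs))                ≡⟨ sum-cong-≗ (N-cons e' xs) ⟩
      sum (λ e → indicator e' e + N G xs e) ≡⟨ ∑-distrib-+ (indicator e') (N G xs) ⟩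
      sum (indicator e') + sum (N G xs)     ≡⟨ cong (_+ sum (N G xs)) (sum-indicator e') ⟩
      suc (sum (N G xs))                    ∎
    where open ≡-Reasoning

  sum-N≤length : ∀ xs → sum (N G xs) ≤ length xs
  sum-N≤length []           = ≤-reflexive (sum-replicate-zero m)
  sum-N≤length (ed e' ∷ xs) rewrite sum-N-cons e' xs = s≤s (sum-N≤length xs)
  sum-N≤length (Ω ∷ xs)     = m≤n⇒m≤1+n (sum-N≤length xs)

  sum-N<length : ∀ xs → Ω ∈ xs → sum (N G xs) < length xs
  sum-N<length (Ω ∷ xs)     (here _)  = s≤s (sum-N≤length xs)
  sum-N<length (Ω ∷ xs)     (there p) = m<n⇒m<1+n (sum-N<length xs p)
  sum-N<length (ed e' ∷ xs) (there p) rewrite sum-N-cons e' xs = s≤s (sum-N<length xs p)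

  popped-length : ∀ (l : Vtx G → List (Sym m)) u x rest → l u ≡ x ∷ rest →
    ∀ v → length (setList G l u rest v) + indicator u v ≡ length (l v)
  popped-length l u x rest pop v with v ≟ u
  ... | yes refl = begin
      length rest + indicator v v ≡⟨ cong (length rest +_) (indicator-self v) ⟩
      length rest + 1             ≡⟨ +-comm (length rest) 1 ⟩
      length (x ∷ rest)           ≡⟨ cong length (sym pop) ⟩
      length (l v)                ∎
    where open ≡-Reasoning
  ... | no v≢u = trans (cong (length (l v) +_) (indicator-other (v≢u ∘ sym))) (+-identityʳ _)

  popped-keeps-Ω : ∀ (l : Vtx G → List (Sym m)) u g rest → l u ≡ ed g ∷ rest →
    ∀ w → Ω ∈ l w → Ω ∈ setList G l u rest w
  popped-keeps-Ω l u g rest pop w Ω∈lw with w ≟ u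
  ... | yes refl = tail-member (subst (Ω ∈_) pop Ω∈lw)
    where
    tail-member : Ω ∈ ed g ∷ rest → Ω ∈ rest
    tail-member (there p) = p
  ... | no _     = Ω∈lw

  record Invariant (S : State G) : Set where
    constructor invariant
    field
      length≡incoming : ∀ v → length (proj₁ S v) ≡ incoming (proj₂ S) v
      Ω-present       : Σ[ r ∈ Vtx G ] Ω ∈ proj₁ S r

  invariant-initial : ∀ l → TreeArray G l → Invariant (l , [])
  invariant-initial l (r , T , _ , array) =
    invariant (λ v → trans (proj₁ (array v)) (sym (incoming-initial v))) (r , Ω∈lr)
    where
    Ω∈lr : Ω ∈ l r
    Ω∈lr with array r
    ... | _ , es , x , lr≡ , _ , last-ok =
      subst (Ω ∈_) (sym lr≡) (∈-++⁺ʳ (map ed es) (here (sym (proj₁ last-ok refl))))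

  invariant-step : ∀ {S S'} → Invariant S → Step G S S' → Invariant S'
  invariant-step (invariant lengths (r , Ω∈lr)) (step l T f g rest ((_ , f-out) , _) pop) =
    invariant lengths′ (r , popped-keeps-Ω l (tgt f) g rest pop r Ω∈lr)
    where
    lengths′ : ∀ v → length (setList G l (tgt f) rest v) ≡ incoming ((f , g) ∷ T) v
    lengths′ v = +-cancelʳ-≡ (indicator (tgt f) v) _ _ (begin
        length (setList G l (tgt f) rest v) + indicator (tgt f) v
                      ≡⟨ popped-length l (tgt f) (ed g) rest pop v ⟩
        length (l v)  ≡⟨ lengths v ⟩
        incoming T v  ≡⟨ incoming-extend T f g v (cong zero-indicator f-out) ⟩
        indicator (tgt f) v + incoming ((f , g) ∷ T) v
                      ≡⟨ +-comm (indicator (tgt f) v) _ ⟩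
        incoming ((f , g) ∷ T) v + indicator (tgt f) v ∎)
      where open ≡-Reasoning

  invariant-reachable : ∀ l → TreeArray G l → ∀ S → Reachable G l S → Invariant S
  invariant-reachable l array _ init        = invariant-initial l array
  invariant-reachable l array _ (next r st) = invariant-step (invariant-reachable l array _ r) st

  -- Step 1 is well defined: Σ_e N(l_{s(e)}, e) is smaller than the number
  -- of pending edges, so some pending edge does not occur in l_{s(e)}.
  R-nonempty : ∀ {S} → Invariant S → Σ[ e ∈ Edge G ] InR G S e
  R-nonempty {l , T} (invariant lengths (r , Ω∈lr)) =
    map₂ (below-zero-indicator (outdeg G T _)) (sum-<-witness _ _ occurrences<pending)
    where
    occurrences<pending : sum (λ e → N G (l (src e)) e) < sum (pending T)
    occurrences<pending = begin-strict
      sum (λ e → N G (l (src e)) e)          ≤⟨ sum-mono (λ e → term≤sum (λ v → N G (l v) e) (src e)) ⟩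
      sum (λ e → sum (λ v → N G (l v) e))    ≡⟨ sym (∑-comm (λ v e → N G (l v) e)) ⟩
      sum (λ v → sum (N G (l v)))            <⟨ sum-mono-< r (sum-N≤length ∘ l) (sum-N<length (l r) Ω∈lr) ⟩
      sum (λ v → length (l v))               ≡⟨ sum-cong-≗ lengths ⟩
      sum (incoming T)                       ≡⟨ sum-incoming T ⟩
      sum (pending T)                        ∎
      where open ≤-Reasoning
    below-zero-indicator : ∀ {x} k → x < zero-indicator k → x ≡ 0 × k ≡ 0
    below-zero-indicator zero (s≤s z≤n) = refl , refl

  -- Step 2 is well defined: the chosen edge f is pending, so it is counted
  -- by the length of l_{t(f)}.
  target-nonempty : ∀ {S} → Invariant S → ∀ f → IsMinR G S f → proj₁ S (tgt f) ≢ []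
  target-nonempty {l , T} (invariant lengths _) f ((_ , f-out) , _) empty =
    n≮0 (subst (1 ≤_) (trans (sym (lengths (tgt f))) (cong length empty)) f-counted)
    where
    f-counted : 1 ≤ incoming T (tgt f)
    f-counted = subst (_≤ incoming T (tgt f))
      (cong₂ _*_ (indicator-self (tgt f)) (cong zero-indicator f-out))
      (term≤sum (λ e → indicator (tgt e) (tgt f) * pending T e) f)

lemma3p2 : (G : Graph) → (∀ v → 0 < indeg G v) →
    (l : Vtx G → List (Sym (Graph.m G))) → TreeArray G l →
    ∀ S → Reachable G l S →
    (Σ[ e ∈ Edge G ] InR G S e)
    × (∀ f → IsMinR G S f → proj₁ S (Graph.tgt G f) ≢ [])
lemma3p2 G _ l array S reachable = R-nonempty inv , target-nonempty inv
  where
  open Counting G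
  inv : Invariant S
  inv = invariant-reachable l array S reachable
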